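{- For every positive integer $n$, $\operatorname{pqn}(K_n) \ge \left\lfloor \frac{3-\sqrt{5}}{8}\, n\right\rfloor$, where $K_n$ is the complete graph on $n$ vertices.
   Context: All graphs are finite, simple and undirected. An edge-weighted graph $\langle G,w\rangle$ is a graph $G=(V,E)$ with $w\colon E\to\mathbb{R}$. A PQ-layout of $\langle G,w\rangle$ with $k$ priority queues consists of a linear ordering $\prec$ of $V$ and a partition of $E$ into $k$ sets $\mathcal{P}_1,\dots,\mathcal{P}_k$ such that there is no $i$ and no two edges $e=uv$, $e'=u'v'$ in $\mathcal{P}_i$ with $w(e)>w(e')$ and $u\prec v$, $u'\prec v$, $v\prec v'$. $\operatorname{pqn}(G,w)$ is the minimum $k\ge0$ such that $\langle G,w\rangle$ has a PQ-layout with $k$ priority queues, and $\operatorname{pqn}(G)$ is the minimum $k\ge0$ such that $\operatorname{pqn}(G,w)\le k$ for every $w\colon E\to\mathbb{R}$. -}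

module Defs where

open import Data.Nat using (ℕ; suc; _+_; _*_; _∸_; _≤_; _<_)
open import Data.Fin using (Fin; toℕ)
open import Data.Fin.Permutation using (Permutation′; _⟨$⟩ʳ_)
open import Relation.Binary.PropositionalEquality using (_≡_; _≢_)
open import Relation.Nullary using (¬_)

-- Edges are the unordered pairs {u,v}
-- with Adj u v; functions on edges are functions on vertex pairs that
-- are symmetric on adjacent pairs.
record Graph (n : ℕ) : Set₁ where
  field
    Adj     : Fin n → Fin n → Set
    sym     : ∀ {u v} → Adj u v → Adj v u
    irrefl  : ∀ {u} → ¬ Adj u u
open Graph public

K : (n : ℕ) → Graph n
K n = record
  { Adj    = λ u v → u ≢ v
  ; sym    = λ u≢v v≡u → u≢v (Relation.Binary.PropositionalEquality.sym v≡u)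
  ; irrefl = λ u≢u → u≢u Relation.Binary.PropositionalEquality.refl
  }

record Weighting {n : ℕ} (G : Graph n) : Set where
  field
    w     : Fin n → Fin n → ℕ
    w-sym : ∀ u v → Adj G u v → w u v ≡ w v u
open Weighting public

-- A PQ-layout of ⟨G,w⟩ with k priority queues: a linear ordering of the
-- vertices (u ≺ v iff pos u < pos v, pos a permutation) and an assignment
-- of each edge to one of k queues (P_1..P_k), such that no queue contains
-- edges e = uv, e' = u'v' with w e > w e' and u ≺ v, u' ≺ v, v ≺ v'.
record PQLayout {n : ℕ} (G : Graph n) (W : Weighting G) (k : ℕ) : Set where
  field
    order   : Permutation′ n
    queue   : Fin n → Fin n → Fin k
    queue-sym : ∀ u v → Adj G u v → queue u v ≡ queue v u
    valid   : ∀ u v u′ v′ → Adj G u v → Adj G u′ v′ →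
              queue u v ≡ queue u′ v′ →
              toℕ (order ⟨$⟩ʳ u)  < toℕ (order ⟨$⟩ʳ v) →
              toℕ (order ⟨$⟩ʳ u′) < toℕ (order ⟨$⟩ʳ v) →
              toℕ (order ⟨$⟩ʳ v)  < toℕ (order ⟨$⟩ʳ v′) →
              ¬ (w W u′ v′ < w W u v)

PqnAtMost : {n : ℕ} → Graph n → ℕ → Set
PqnAtMost G k = (W : Weighting G) → PQLayout G W k

-- "pqn(G) ≥ m": pqn(G) is the minimum k with PqnAtMost G k, so this says
-- every such k is at least m.
PqnAtLeast : {n : ℕ} → Graph n → ℕ → Set
PqnAtLeast G m = ∀ k → PqnAtMost G k → m ≤ k

-- m ≤ ((3 - √5)/8) n  ⇔  8m ≤ 3n  and  5n² ≤ (3n - 8m)²   (m, n ≥ 0).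
BelowRatio : ℕ → ℕ → Set
BelowRatio n m = (8 * m ≤ 3 * n) × (5 * (n * n) ≤ (3 * n ∸ 8 * m) * (3 * n ∸ 8 * m))
  where open import Data.Product using (_×_)

IsFloorRatio : ℕ → ℕ → Set
IsFloorRatio n m = BelowRatio n m × ¬ BelowRatio n (suc m)
  where open import Data.Product using (_×_)

-- Weight the edge uv of K_n by (u + v) mod n, a proper edge colouring with n
-- colours. In a layout with k queues let a_i be the vertex at position i and
-- b_j the one at position p + j (i < p, j < q). For edges a_i b_j, a_i′ b_j′
-- in one queue with j < j′ the queue condition forces w(a_i b_j) ≤ w(a_i′ b_j′),
-- so w(a_i b_j) + j strictly increases with j inside a queue; as the colouring
-- is proper, the queue together with this number (< n + q) determines (i, j).
-- Hence pq ≤ k(n + q), and p = q = ⌊n/2⌋ yields k ≥ m whenever 8m < n, while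
-- ⌊((3 - √5)/8) n⌋ < n/8.
module Submission where

open import Defs hiding (sym)
open import Data.Nat using (ℕ; zero; suc; _+_; _*_; _∸_; _≤_; _<_; z≤n; s≤s; s≤s⁻¹; ⌊_/2⌋; NonZero; >-nonZero)
open import Data.Nat.Properties
open import Algebra.Properties.CommutativeSemigroup +-commutativeSemigroup using (xy∙z≈xz∙y)
open import Data.Nat.DivMod using (_%_; _/_; m%n<n; m%n≤n; m%n%n≡m%n; %-distribˡ-+; m≡m%n+[m/n]*n; [m+kn]%n≡m%n; m<n⇒m%n≡m)
open import Data.Nat.Tactic.RingSolver using (solve-∀)
open import Data.Fin using (Fin; toℕ; fromℕ<)
open import Data.Fin.Properties using (toℕ<n; toℕ-fromℕ<; toℕ-injective; fromℕ<-injective; injective⇒≤; *↔×)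
open import Data.Fin.Permutation using (_⟨$⟩ʳ_; _⟨$⟩ˡ_; inverseʳ)
open import Data.Product using (_×_; _,_)
open import Data.Product.Properties using (,-injective)
open import Function.Bundles using (Injection; mk↣)
open import Function.Construct.Composition using (_↣-∘_)
open import Function.Construct.Symmetry using (↔-sym)
open import Function.Definitions using (Injective)
open import Function.Properties.Inverse using (↔⇒↣)
open import Relation.Binary.Definitions using (tri<; tri≈; tri>)
open import Relation.Binary.PropositionalEquality
open import Relation.Nullary using (contradiction)

×-injective⇒≤ : ∀ {a b c d} {f : Fin a × Fin b → Fin c × Fin d} →
                Injective _≡_ _≡_ f → a * b ≤ c * d
×-injective⇒≤ f-inj =
  injective⇒≤ (Injection.injective (↔⇒↣ (↔-sym *↔×) ↣-∘ (mk↣ f-inj ↣-∘ ↔⇒↣ *↔×)))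

module _ {n : ℕ} .{{_ : NonZero n}} where
  open ≡-Reasoning

  [m%n+o]%n≡[m+o]%n : ∀ m o → (m % n + o) % n ≡ (m + o) % n
  [m%n+o]%n≡[m+o]%n m o = begin
    (m % n + o) % n            ≡⟨ %-distribˡ-+ (m % n) o n ⟩
    (m % n % n + o % n) % n    ≡⟨ cong (λ x → (x + o % n) % n) (m%n%n≡m%n m n) ⟩
    (m % n + o % n) % n        ≡⟨ %-distribˡ-+ m o n ⟨
    (m + o) % n                ∎

  m+[n∸m%n]≡[1+m/n]*n : ∀ m → m + (n ∸ m % n) ≡ suc (m / n) * n
  m+[n∸m%n]≡[1+m/n]*n m = begin
    m + (n ∸ m % n)                    ≡⟨ cong (_+ (n ∸ m % n)) (m≡m%n+[m/n]*n m n) ⟩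
    m % n + m / n * n + (n ∸ m % n)    ≡⟨ xy∙z≈xz∙y (m % n) (m / n * n) (n ∸ m % n) ⟩
    m % n + (n ∸ m % n) + m / n * n    ≡⟨ cong (_+ m / n * n) (m+[n∸m]≡n (m%n≤n m n)) ⟩
    n + m / n * n                      ∎

  [[m+o]%n+[n∸o%n]]%n≡m : ∀ {m} o → m < n → ((m + o) % n + (n ∸ o % n)) % n ≡ m
  [[m+o]%n+[n∸o%n]]%n≡m {m} o m<n = begin
    ((m + o) % n + (n ∸ o % n)) % n    ≡⟨ [m%n+o]%n≡[m+o]%n (m + o) (n ∸ o % n) ⟩
    (m + o + (n ∸ o % n)) % n          ≡⟨ cong (_% n) (+-assoc m o (n ∸ o % n)) ⟩
    (m + (o + (n ∸ o % n))) % n        ≡⟨ cong (λ x → (m + x) % n) (m+[n∸m%n]≡[1+m/n]*n o) ⟩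
    (m + suc (o / n) * n) % n          ≡⟨ [m+kn]%n≡m%n m (suc (o / n)) n ⟩
    m % n                              ≡⟨ m<n⇒m%n≡m m<n ⟩
    m                                  ∎

  [m+o]%n-cancelʳ : ∀ {m m′} o → m < n → m′ < n → (m + o) % n ≡ (m′ + o) % n → m ≡ m′
  [m+o]%n-cancelʳ {m} {m′} o m<n m′<n eq = begin
    m                                    ≡⟨ [[m+o]%n+[n∸o%n]]%n≡m o m<n ⟨
    ((m + o) % n + (n ∸ o % n)) % n      ≡⟨ cong (λ x → (x + (n ∸ o % n)) % n) eq ⟩
    ((m′ + o) % n + (n ∸ o % n)) % n     ≡⟨ [[m+o]%n+[n∸o%n]]%n≡m o m′<n ⟩
    m′                                   ∎

sumModWeighting : (n : ℕ) .{{_ : NonZero n}} → Weighting (K n)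
sumModWeighting n = record
  { w     = λ u v → (toℕ u + toℕ v) % n
  ; w-sym = λ u v _ → cong (_% n) (+-comm (toℕ u) (toℕ v))
  }

sumModWeighting-injectiveˡ : ∀ n .{{_ : NonZero n}} (v : Fin n) →
                             Injective _≡_ _≡_ (λ u → w (sumModWeighting n) u v)
sumModWeighting-injectiveˡ n v {u} {u′} eq =
  toℕ-injective ([m+o]%n-cancelʳ (toℕ v) (toℕ<n u) (toℕ<n u′) eq)

sumModWeighting<n : ∀ n .{{_ : NonZero n}} (u v : Fin n) → w (sumModWeighting n) u v < n
sumModWeighting<n n u v = m%n<n (toℕ u + toℕ v) n

module _ {n k : ℕ} {G : Graph n} {W : Weighting G} (L : PQLayout G W k) where
  open PQLayout L

  position : Fin n → ℕ
  position v = toℕ (order ⟨$⟩ʳ v)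

  vertexAt : ∀ {i} → i < n → Fin n
  vertexAt i<n = order ⟨$⟩ˡ fromℕ< i<n

  position-vertexAt : ∀ {i} (i<n : i < n) → position (vertexAt i<n) ≡ i
  position-vertexAt i<n = trans (cong toℕ (inverseʳ order)) (toℕ-fromℕ< i<n)

  queue-weight-mono : ∀ {u v u′ v′} → Adj G u v → Adj G u′ v′ → queue u v ≡ queue u′ v′ →
                      position u < position v → position u′ < position v → position v < position v′ →
                      w W u v ≤ w W u′ v′
  queue-weight-mono {u} {v} {u′} {v′} uv u′v′ same u≺v u′≺v v≺v′ =
    ≮⇒≥ (valid u v u′ v′ uv u′v′ same u≺v u′≺v v≺v′)

pq≤k*[b+q] : ∀ {n k b p q} {W : Weighting (K n)} →
             (∀ v → Injective _≡_ _≡_ (λ u → w W u v)) → (∀ u v → w W u v < b) →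
             PQLayout (K n) W k → p + q ≤ n → p * q ≤ k * (b + q)
pq≤k*[b+q] {n} {k} {b} {p} {q} {W} w-injˡ w<b L p+q≤n = ×-injective⇒≤ label-injective
  where
  open PQLayout L using (queue)

  left<n : (i : Fin p) → toℕ i < n
  left<n i = <-≤-trans (toℕ<n i) (m+n≤o⇒m≤o p p+q≤n)

  right<n : (j : Fin q) → p + toℕ j < n
  right<n j = <-≤-trans (+-monoʳ-< p (toℕ<n j)) p+q≤n

  left : Fin p → Fin n
  left i = vertexAt L (left<n i)

  right : Fin q → Fin n
  right j = vertexAt L (right<n j)

  position-left : ∀ i → position L (left i) ≡ toℕ i
  position-left i = position-vertexAt L (left<n i)

  position-right : ∀ j → position L (right j) ≡ p + toℕ j
  position-right j = position-vertexAt L (right<n j)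

  left≺right : ∀ i j → position L (left i) < position L (right j)
  left≺right i j rewrite position-left i | position-right j = <-≤-trans (toℕ<n i) (m≤m+n p (toℕ j))

  left≢right : ∀ i j → left i ≢ right j
  left≢right i j eq = <⇒≢ (left≺right i j) (cong (position L) eq)

  φ : Fin p → Fin q → ℕ
  φ i j = w W (left i) (right j) + toℕ j

  φ<b+q : ∀ i j → φ i j < b + q
  φ<b+q i j = +-mono-< (w<b (left i) (right j)) (toℕ<n j)

  φ-increasing : ∀ {i j i′ j′} → queue (left i) (right j) ≡ queue (left i′) (right j′) →
                 toℕ j < toℕ j′ → φ i j < φ i′ j′
  φ-increasing {i} {j} {i′} {j′} same j<j′ = +-mono-≤-< weight-mono j<j′
    where
    right≺right : position L (right j) < position L (right j′)
    right≺right rewrite position-right j | position-right j′ = +-monoʳ-< p j<j′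
    weight-mono : w W (left i) (right j) ≤ w W (left i′) (right j′)
    weight-mono = queue-weight-mono L (left≢right i j) (left≢right i′ j′) same
                    (left≺right i j) (left≺right i′ j) right≺right

  column-determined : ∀ {i j i′ j′} → queue (left i) (right j) ≡ queue (left i′) (right j′) →
                      φ i j ≡ φ i′ j′ → j ≡ j′
  column-determined {j = j} {j′ = j′} same eq with <-cmp (toℕ j) (toℕ j′)
  ... | tri< j<j′ _ _ = contradiction eq (<⇒≢ (φ-increasing same j<j′))
  ... | tri≈ _ j≡j′ _ = toℕ-injective j≡j′
  ... | tri> _ _ j′<j = contradiction (sym eq) (<⇒≢ (φ-increasing (sym same) j′<j))

  row-determined : ∀ {i i′ j} → φ i j ≡ φ i′ j → i ≡ i′
  row-determined {i} {i′} {j} eq = toℕ-injective (begin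
    toℕ i                  ≡⟨ position-left i ⟨
    position L (left i)    ≡⟨ cong (position L) (w-injˡ (right j) (+-cancelʳ-≡ (toℕ j) _ _ eq)) ⟩
    position L (left i′)   ≡⟨ position-left i′ ⟩
    toℕ i′                 ∎)
    where open ≡-Reasoning

  label : Fin p × Fin q → Fin k × Fin (b + q)
  label (i , j) = queue (left i) (right j) , fromℕ< (φ<b+q i j)

  label-injective : Injective _≡_ _≡_ label
  label-injective {i , j} {i′ , j′} eq with same , φ-eq ← ,-injective eq
    with refl ← column-determined same (fromℕ<-injective _ _ (φ<b+q i j) (φ<b+q i′ j′) φ-eq)
    = cong (_, j) (row-determined (fromℕ<-injective _ _ (φ<b+q i j) (φ<b+q i′ j) φ-eq))

⌊n/2⌋+⌊n/2⌋≤n : ∀ n → ⌊ n /2⌋ + ⌊ n /2⌋ ≤ n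
⌊n/2⌋+⌊n/2⌋≤n n = ≤-trans (+-monoʳ-≤ ⌊ n /2⌋ (⌊n/2⌋≤⌈n/2⌉ n)) (≤-reflexive (⌊n/2⌋+⌈n/2⌉≡n n))

n≤1+⌊n/2⌋+⌊n/2⌋ : ∀ n → n ≤ suc (⌊ n /2⌋ + ⌊ n /2⌋)
n≤1+⌊n/2⌋+⌊n/2⌋ zero          = z≤n
n≤1+⌊n/2⌋+⌊n/2⌋ (suc zero)    = s≤s z≤n
n≤1+⌊n/2⌋+⌊n/2⌋ (suc (suc n)) =
  s≤s (s≤s (≤-trans (n≤1+⌊n/2⌋+⌊n/2⌋ n) (≤-reflexive (sym (+-suc ⌊ n /2⌋ ⌊ n /2⌋)))))

h*h≤k*[n+h]⇒m≤k : ∀ {n h k m} → n ≤ suc (h + h) → 8 * m < n → h * h ≤ k * (n + h) → m ≤ k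
h*h≤k*[n+h]⇒m≤k {n} {h} {k} {m} n≤1+2h 8m<n hh≤ = ≮⇒≥ (λ k<m → <⇒≱ (k*[n+h]<h*h k<m) hh≤)
  where
  open ≤-Reasoning

  4m≤h : 4 * m ≤ h
  4m≤h = *-cancelˡ-≤ 2 (begin
    2 * (4 * m)  ≡⟨ *-assoc 2 4 m ⟨
    8 * m        ≤⟨ s≤s⁻¹ (<-≤-trans 8m<n n≤1+2h) ⟩
    h + h        ≡⟨ cong (h +_) (+-identityʳ h) ⟨
    2 * h        ∎)

  4x≡x+[x+x]+x : ∀ x → 4 * x ≡ x + (x + x) + x
  4x≡x+[x+x]+x = solve-∀

  k*[n+h]<h*h : k < m → k * (n + h) < h * h
  k*[n+h]<h*h k<m = begin-strict
    k * (n + h)              ≤⟨ *-monoʳ-≤ k (+-monoˡ-≤ h n≤h+[h+h]) ⟩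
    k * (h + (h + h) + h)    ≡⟨ cong (k *_) (4x≡x+[x+x]+x h) ⟨
    k * (4 * h)              ≡⟨ *-assoc k 4 h ⟨
    k * 4 * h                ≡⟨ cong (_* h) (*-comm k 4) ⟩
    4 * k * h                <⟨ *-monoˡ-< h 4k<h ⟩
    h * h                    ∎
    where
    4k<h : 4 * k < h
    4k<h = <-≤-trans (*-monoʳ-< 4 k<m) 4m≤h
    instance
      h-nonZero : NonZero h
      h-nonZero = >-nonZero (≤-<-trans z≤n 4k<h)
    n≤h+[h+h] : n ≤ h + (h + h)
    n≤h+[h+h] = ≤-trans n≤1+2h (+-monoˡ-≤ (h + h) (≤-<-trans z≤n 4k<h))

BelowRatio⇒8m<n : ∀ {n m} → 1 ≤ n → BelowRatio n m → 8 * m < n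
BelowRatio⇒8m<n {n} {m} 1≤n (_ , 5n²≤d²) = ≰⇒> (λ n≤8m → <⇒≱ (d²<5n² n≤8m) 5n²≤d²)
  where
  open ≤-Reasoning

  d : ℕ
  d = 3 * n ∸ 8 * m

  [2x]²≡4x² : ∀ x → 2 * x * (2 * x) ≡ 4 * (x * x)
  [2x]²≡4x² = solve-∀

  d²<5n² : n ≤ 8 * m → d * d < 5 * (n * n)
  d²<5n² n≤8m = begin-strict
    d * d              ≤⟨ *-mono-≤ d≤2n d≤2n ⟩
    2 * n * (2 * n)    ≡⟨ [2x]²≡4x² n ⟩
    4 * (n * n)        <⟨ m<n+m (4 * (n * n)) (*-mono-≤ 1≤n 1≤n) ⟩
    5 * (n * n)        ∎
    where
    d≤2n : d ≤ 2 * n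
    d≤2n = ≤-trans (∸-monoʳ-≤ (3 * n) n≤8m) (≤-reflexive (m+n∸m≡n n (2 * n)))

pqn[K]≥ : ∀ {n m} → 8 * m < n → PqnAtLeast (K n) m
pqn[K]≥ {n} {m} 8m<n k pqn≤k =
  h*h≤k*[n+h]⇒m≤k (n≤1+⌊n/2⌋+⌊n/2⌋ n) 8m<n
    (pq≤k*[b+q] {p = ⌊ n /2⌋} {q = ⌊ n /2⌋} (sumModWeighting-injectiveˡ n) (sumModWeighting<n n)
                (pqn≤k (sumModWeighting n)) (⌊n/2⌋+⌊n/2⌋≤n n))
  where
  instance
    n-nonZero : NonZero n
    n-nonZero = >-nonZero (≤-<-trans z≤n 8m<n)

corollary3p4 : (n : ℕ) → 1 ≤ n → (m : ℕ) → IsFloorRatio n m → PqnAtLeast (K n) m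
corollary3p4 n 1≤n m (belowRatio , _) = pqn[K]≥ (BelowRatio⇒8m<n {m = m} 1≤n belowRatio)
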